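{- Let $D,A$ be sets, let $v:\mathbb{X}\to \mathsf{R}(D,A)$ be a valuation, and let $t,s$ be lattice terms. Write $[\![t]\!]_v=(\alpha_t,X_t)$ and $[\![s]\!]_v=(\alpha_s,X_s)$. If there is $a\in A$ with $a\in\alpha_t\setminus\alpha_s$, then the inclusion $t\leq s$ fails in the lattice $\mathsf{R}(E,B)$ where $B=\emptyset$ and $E$ is a singleton, i.e. there is a valuation $w:\mathbb{X}\to\mathsf{R}(E,B)$ with $[\![t]\!]_w\not\leq[\![s]\!]_w$.
   Context: Lattice terms are generated by $t::=x\mid\top\mid t\wedge t\mid\bot\mid t\vee t$ with $x$ in a set of variables $\mathbb{X}$; for a valuation $w:\mathbb{X}\to L$ into a lattice $L$, $[\![t]\!]_w$ denotes the value of $t$ computed in $L$. For sets $D$ (values) and $A$ (attributes), $D^A$ is the set of functions $A\to D$, and for $f,g\in D^A$, $\delta(f,g)=\{a\in A\mid f(a)\neq g(a)\}\subseteq A$. For $\alpha\subseteq A$, a set $X\subseteq D^A$ is $\alpha$-closed if $f\in X$ and $\delta(f,g)\subseteq\alpha$ imply $g\in X$; the $\alpha$-closure of $X$ is $\overline{X}^{\alpha}=\{g\in D^A\mid \exists f\in X,\ \delta(f,g)\subseteq\alpha\}$. The relational lattice $\mathsf{R}(D,A)$ is the set of pairs $(\alpha,X)$ with $\alpha\subseteq A$ and $X\subseteq D^A$ $\alpha$-closed, ordered componentwise (equivalently, identified with the subsets $\alpha\cup X$ of $A\cup D^A$ ordered by inclusion); meets are componentwise intersections, $(\alpha,X)\vee(\beta,Y)=(\alpha\cup\beta,\overline{X\cup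 Y}^{\alpha\cup\beta})$, top $(A,D^A)$, bottom $(\emptyset,\emptyset)$. An inclusion $t\leq s$ fails in a lattice $L$ if $[\![t]\!]_w\not\leq[\![s]\!]_w$ for some valuation $w:\mathbb{X}\to L$. -}

module Defs where

open import Level using (0ℓ)
open import Data.Product using (Σ; _×_; _,_; ∃)
open import Data.Sum using (_⊎_)
open import Data.Unit using (⊤)
open import Data.Empty using (⊥)
open import Relation.Nullary using (¬_)
open import Relation.Binary.PropositionalEquality using (_≡_)

data Term (𝕏 : Set) : Set where
  var  : 𝕏 → Term 𝕏
  top  : Term 𝕏
  _∧_  : Term 𝕏 → Term 𝕏 → Term 𝕏
  bot  : Term 𝕏
  _∨_  : Term 𝕏 → Term 𝕏 → Term 𝕏

Subset : Set → Set₁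
Subset S = S → Set

_⊆_ : {S : Set} → Subset S → Subset S → Set
P ⊆ Q = ∀ x → P x → Q x

δ⊆ : {D A : Set} → (A → D) → (A → D) → Subset A → Set
δ⊆ f g α = ∀ a → ¬ (f a ≡ g a) → α a

IsClosed : {D A : Set} → Subset A → Subset (A → D) → Set
IsClosed {D} {A} α X = (f g : A → D) → X f → δ⊆ f g α → X g

closure : {D A : Set} → Subset A → Subset (A → D) → Subset (A → D)
closure α X g = Σ _ λ f → X f × δ⊆ f g α

-- Pairs (α , X); an element of R(D,A) is such a pair with X α-closed
record RPair (D A : Set) : Set₁ where
  constructor ⟨_,_⟩
  field
    att : Subset A
    tup : Subset (A → D)
open RPair public

InR : {D A : Set} → RPair D A → Set
InR p = IsClosed (att p) (tup p)

_≤R_ : {D A : Set} → RPair D A → RPair D A → Set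
p ≤R q = (att p ⊆ att q) × (tup p ⊆ tup q)

⊤R : {D A : Set} → RPair D A
⊤R = ⟨ (λ _ → ⊤) , (λ _ → ⊤) ⟩

⊥R : {D A : Set} → RPair D A
⊥R = ⟨ (λ _ → ⊥) , (λ _ → ⊥) ⟩

_∧R_ : {D A : Set} → RPair D A → RPair D A → RPair D A
p ∧R q = ⟨ (λ a → att p a × att q a) , (λ f → tup p f × tup q f) ⟩

_∨R_ : {D A : Set} → RPair D A → RPair D A → RPair D A
p ∨R q = ⟨ αβ , closure αβ (λ f → tup p f ⊎ tup q f) ⟩
  where
  αβ = λ a → att p a ⊎ att q a

⟦_⟧ : {𝕏 D A : Set} → Term 𝕏 → (𝕏 → RPair D A) → RPair D A
⟦ var x ⟧ w = w x
⟦ top ⟧ w = ⊤R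
⟦ t ∧ s ⟧ w = ⟦ t ⟧ w ∧R ⟦ s ⟧ w
⟦ bot ⟧ w = ⊥R
⟦ t ∨ s ⟧ w = ⟦ t ⟧ w ∨R ⟦ s ⟧ w

FailsIn : {𝕏 : Set} → Term 𝕏 → Term 𝕏 → (D A : Set) → Set₁
FailsIn t s D A =
  Σ (_ → RPair D A) λ w → ((x : _) → InR (w x)) × ¬ (⟦ t ⟧ w ≤R ⟦ s ⟧ w)

-- The attribute component of a term's value is computed pointwise: a ∈ α_t depends only on
-- whether a ∈ α_x for the variables x, through the Boolean connectives. Collapsing each
-- v x to the pair (∅ , {all tuples} or ∅) according to a ∈ α_x therefore yields a valuation
-- whose tuple components follow the same Boolean computation, and the attribute a witnessing
-- α_t ⊈ α_s becomes a tuple witnessing X_t ⊈ X_s.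
module Submission where

open import Defs
open import Data.Product using (Σ; _×_; _,_; proj₂)
open import Data.Sum using (inj₁; inj₂)
open import Data.Unit using (⊤; tt)
open import Data.Empty using (⊥)
open import Function.Bundles using (_⇔_; mk⇔; Equivalence)
open import Relation.Nullary using (¬_)
open import Relation.Binary.PropositionalEquality using (refl)

constant-isClosed : {D A : Set} (α : Subset A) (P : Set) → IsClosed {D} α (λ _ → P)
constant-isClosed α P f g p _ = p

δ⊆-refl : {D A : Set} (f : A → D) (α : Subset A) → δ⊆ f f α
δ⊆-refl f α a f≢f with f≢f refl
... | ()

module _ {𝕏 D A : Set} (v : 𝕏 → RPair D A) (a : A) where

  collapseAt : {E B : Set} → 𝕏 → RPair E B
  collapseAt x = ⟨ (λ _ → ⊥) , (λ _ → att (v x) a) ⟩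

  tup-⟦⟧-collapseAt : {E B : Set} (t : Term 𝕏) (g : B → E) →
                      tup (⟦ t ⟧ collapseAt) g ⇔ att (⟦ t ⟧ v) a
  tup-⟦⟧-collapseAt t g = mk⇔ (to t g) (from t g)
    where
    to : (t : Term 𝕏) (g : _) → tup (⟦ t ⟧ collapseAt) g → att (⟦ t ⟧ v) a
    to (var x) g p = p
    to top     g p = tt
    to (t ∧ s) g (p , q) = to t g p , to s g q
    to (t ∨ s) g (f , inj₁ p , _) = inj₁ (to t f p)
    to (t ∨ s) g (f , inj₂ q , _) = inj₂ (to s f q)

    from : (t : Term 𝕏) (g : _) → att (⟦ t ⟧ v) a → tup (⟦ t ⟧ collapseAt) g
    from (var x) g p = p
    from top     g p = tt
    from (t ∧ s) g (p , q) = from t g p , from s g q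
    from (t ∨ s) g (inj₁ p) = g , inj₁ (from t g p) , δ⊆-refl g _
    from (t ∨ s) g (inj₂ q) = g , inj₂ (from s g q) , δ⊆-refl g _

mainTheorem1 : (𝕏 D A : Set) (v : 𝕏 → RPair D A) → ((x : 𝕏) → InR (v x)) →
    (t s : Term 𝕏) →
    Σ A (λ a → att (⟦ t ⟧ v) a × ¬ att (⟦ s ⟧ v) a) →
    FailsIn t s ⊤ ⊥
mainTheorem1 𝕏 D A v _ t s (a , a∈αt , a∉αs) =
  collapseAt v a ,
  (λ x → constant-isClosed _ (att (v x) a)) ,
  λ t≤s → a∉αs (Equivalence.to (tup-⟦⟧-collapseAt v a s empty)
                  (proj₂ t≤s empty (Equivalence.from (tup-⟦⟧-collapseAt v a t empty) a∈αt)))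
  where
  empty : ⊥ → ⊤
  empty ()
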